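{- Let $\Bbbk$ be a field of characteristic zero, $N$ a positive integer, $M=\bigoplus_{k\in\frac{1}{N}\mathbb{Z}}M_k$ a graded algebra of type $\frac{1}{N}\mathbb{Z}$ over $\Bbbk$, $\partial$ a derivation of $M$ of degree $2$, and $\mathcal{E}_4\in M_4$. Let $\widetilde{M}=M[\mathcal{E}_2]$ (polynomial ring, $\mathcal{E}_2$ of degree $2$) and let $\mathscr{D}$ be the derivation of $\widetilde{M}$ with $\mathscr{D}(f)=\partial f+k\,\mathcal{E}_2 f$ for $f\in M_k$ and $\mathscr{D}(\mathcal{E}_2)=\mathcal{E}_4+\mathcal{E}_2^2$. Then for every $f\in M_k$, $k\in\frac{1}{N}\mathbb{Z}$, and every integer $n\ge0$, $$\partial_{(n)}f=\sum_{j=0}^n(-1)^{n-j}\frac{n!\,(k+j)_{n-j}}{(n-j)!\,j!}\,\mathcal{E}_2^{\,n-j}\,\mathscr{D}^jf.$$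
   Context: A graded algebra of type $\frac{1}{N}\mathbb{Z}$ over $\Bbbk$ is a commutative, associative $\Bbbk$-algebra with unit $M=\bigoplus_{k\in\frac{1}{N}\mathbb{Z}}M_k$ with $M_kM_l\subseteq M_{k+l}$, $1\in M_0$, $\dim_\Bbbk M_k<\infty$. A degree-$2$ derivation maps $M_k$ into $M_{k+2}$. $(x)_0=1$, $(x)_n=x(x+1)\cdots(x+n-1)$. For $h\in M_k$: $\partial_{(0)}h=h$, $\partial_{(1)}h=\partial h$, $\partial_{(j+1)}h=\partial(\partial_{(j)}h)+j(j+k-1)\mathcal{E}_4\,\partial_{(j-1)}h$ for $j\ge1$. $\mathscr{D}^j$ is the $j$-th iterate of $\mathscr{D}$. -}

module Defs where

open import Level using (Level; _⊔_) renaming (suc to lsuc)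
open import Data.Nat as ℕ using (ℕ; zero; suc; _∸_; _!)
open import Data.Nat.Properties using (_!*_!≢0; n>0⇒n≢0)
open import Data.Nat.DivMod as ℕ using ()
open import Data.Integer as ℤ using (ℤ; +_; -[1+_])
open import Data.Fin using (Fin; zero; suc)
open import Data.List using (List; []; _∷_)
open import Data.List.Relation.Unary.All using (All)
open import Data.Product using (Σ; ∃; _×_; _,_)
open import Function using (_∘_; Injective)
open import Relation.Binary.PropositionalEquality using (_≡_; _≢_)
open import Relation.Nullary using (¬_)
open import Algebra.Bundles using (CommutativeRing)
open import Algebra.Morphism.Structures using (IsRingHomomorphism)

module RingOps {c ℓ} (R : CommutativeRing c ℓ) where
  open CommutativeRing R hiding (zero)

  fromℕ : ℕ → Carrier
  fromℕ zero    = 0#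
  fromℕ (suc n) = 1# + fromℕ n

  fromℤ : ℤ → Carrier
  fromℤ (+ n)      = fromℕ n
  fromℤ -[1+ n ]   = - fromℕ (suc n)

  pow : Carrier → ℕ → Carrier
  pow x zero    = 1#
  pow x (suc n) = x * pow x n

  poch : Carrier → ℕ → Carrier
  poch x zero    = 1#
  poch x (suc n) = poch x n * (x + fromℕ n)

  sumFin : ∀ {n} → (Fin n → Carrier) → Carrier
  sumFin {zero}  f = 0#
  sumFin {suc n} f = f zero + sumFin (f ∘ suc)

  sumTo : ℕ → (ℕ → Carrier) → Carrier
  sumTo zero    f = f 0
  sumTo (suc n) f = sumTo n f + f (suc n)

record Field c ℓ : Set (lsuc (c ⊔ ℓ)) where
  field
    commutativeRing : CommutativeRing c ℓ
  open CommutativeRing commutativeRing hiding (zero) public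
  field
    0≉1   : ¬ (0# ≈ 1#)
    inv   : (x : Carrier) → ¬ (x ≈ 0#) → Carrier
    inv-r : ∀ x (p : ¬ (x ≈ 0#)) → x * inv x p ≈ 1#

CharZero : ∀ {c ℓ} → Field c ℓ → Set ℓ
CharZero K = ∀ n → n ≢ 0 → ¬ (fromℕ n ≈ 0#)
  where open Field K
        open RingOps commutativeRing

-- Graded commutative 𝕜-algebras of type (1/N)ℤ.
-- The homogeneous component of degree a/N (a : ℤ) is the predicate  Hom a.

record GradedAlgebra {k kℓ} (K : Field k kℓ) (N : ℕ) m mℓ h
       : Set (k ⊔ kℓ ⊔ lsuc (m ⊔ mℓ ⊔ h)) where
  private module K = Field K
  field
    cring : CommutativeRing m mℓ
  open CommutativeRing cring hiding (zero) public
  open RingOps cring public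
  field
    ι      : K.Carrier → Carrier
    ι-hom  : IsRingHomomorphism K.rawRing rawRing ι
    Hom      : ℤ → Carrier → Set h
    Hom-resp : ∀ {a x y} → x ≈ y → Hom a x → Hom a y
    Hom-0    : ∀ {a} → Hom a 0#
    Hom-+    : ∀ {a x y} → Hom a x → Hom a y → Hom a (x + y)
    Hom-·    : ∀ {a x} (c : K.Carrier) → Hom a x → Hom a (ι c * x)
    Hom-*    : ∀ {a b x y} → Hom a x → Hom b y → Hom (a ℤ.+ b) (x * y)
    Hom-1    : Hom (+ 0) 1#
    -- M is the direct sum of the M_k: every element is a finite sum of
    -- homogeneous elements ...
    Hom-span : ∀ x → Σ ℕ λ n → Σ (Fin n → ℤ) λ d → Σ (Fin n → Carrier) λ v →
                 (∀ i → Hom (d i) (v i)) × (x ≈ sumFin v)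
    -- ... and homogeneous elements of pairwise distinct degrees are independent
    Hom-indep : ∀ n (d : Fin n → ℤ) (v : Fin n → Carrier) → Injective _≡_ _≡_ d →
                 (∀ i → Hom (d i) (v i)) → sumFin v ≈ 0# → ∀ i → v i ≈ 0#
    Hom-finDim : ∀ a → Σ ℕ λ n → Σ (Fin n → Carrier) λ b → (∀ i → Hom a (b i)) ×
                 (∀ x → Hom a x → Σ (Fin n → K.Carrier) λ cs → x ≈ sumFin (λ i → ι (cs i) * b i))

degree : ∀ {k kℓ} (K : Field k kℓ) → CharZero K → (N : ℕ) → 0 ℕ.< N → ℤ → Field.Carrier K
degree K char0 N N>0 a = fromℤ a * inv (fromℕ N) (char0 N (n>0⇒n≢0 N>0))
  where open Field K
        open RingOps commutativeRing

record IsDerivation2 {k kℓ} {K : Field k kℓ} {N m mℓ h}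
       (M : GradedAlgebra K N m mℓ h)
       (∂ : GradedAlgebra.Carrier M → GradedAlgebra.Carrier M)
       : Set (k ⊔ m ⊔ mℓ ⊔ h) where
  open GradedAlgebra M
  field
    ∂-cong    : ∀ {x y} → x ≈ y → ∂ x ≈ ∂ y
    ∂-+       : ∀ x y → ∂ (x + y) ≈ ∂ x + ∂ y
    ∂-·       : ∀ c x → ∂ (ι c * x) ≈ ι c * ∂ x
    ∂-leibniz : ∀ x y → ∂ (x * y) ≈ x * ∂ y + ∂ x * y
    ∂-degree  : ∀ {a x} → Hom a x → Hom (a ℤ.+ ℤ.+ (2 ℕ.* N)) (∂ x)

-- Polynomial ring  M̃ = M[E₂]  over M, given as a commutative ring with a
-- ring homomorphism  incl : M → M̃  and an element E₂ such that every
-- element is uniquely a polynomial in E₂ with coefficients in M.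

evalPoly : ∀ {a b ℓ} {A : Set a} (R : CommutativeRing b ℓ) →
           (A → CommutativeRing.Carrier R) → CommutativeRing.Carrier R →
           List A → CommutativeRing.Carrier R
evalPoly R incl E₂ []       = 0#  where open CommutativeRing R hiding (zero)
evalPoly R incl E₂ (g ∷ gs) = incl g + E₂ * evalPoly R incl E₂ gs
  where open CommutativeRing R hiding (zero)

record PolynomialExtension {k kℓ} {K : Field k kℓ} {N m mℓ h}
       (M : GradedAlgebra K N m mℓ h) t tℓ
       : Set (lsuc (t ⊔ tℓ) ⊔ m ⊔ mℓ) where
  private module M = GradedAlgebra M
  field
    cring : CommutativeRing t tℓ
  open CommutativeRing cring hiding (zero) public
  open RingOps cring public
  field
    incl      : M.Carrier → Carrier
    incl-hom  : IsRingHomomorphism M.rawRing rawRing incl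
    E₂        : Carrier
    poly-surj : ∀ x → Σ (List M.Carrier) λ gs → x ≈ evalPoly cring incl E₂ gs
    poly-inj  : ∀ gs → evalPoly cring incl E₂ gs ≈ 0# → All (M._≈ M.0#) gs

-- The modified derivations ∂₍ⱼ₎ of an element h ∈ M_k  (k = kk ∈ 𝕜):
--   ∂₍₀₎h = h,  ∂₍₁₎h = ∂h,
--   ∂₍ⱼ₊₁₎h = ∂(∂₍ⱼ₎h) + j(j+k-1) E₄ ∂₍ⱼ₋₁₎h   (j ≥ 1)

serreIter : ∀ {k kℓ} {K : Field k kℓ} {N m mℓ h}
            (M : GradedAlgebra K N m mℓ h) →
            (∂ : GradedAlgebra.Carrier M → GradedAlgebra.Carrier M) →
            (E₄ : GradedAlgebra.Carrier M) → (kk : Field.Carrier K) →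
            ℕ → GradedAlgebra.Carrier M → GradedAlgebra.Carrier M
serreIter {K = K} M ∂ E₄ kk zero          x = x
serreIter {K = K} M ∂ E₄ kk (suc zero)    x = ∂ x
serreIter {K = K} M ∂ E₄ kk (suc (suc j)) x =
  ∂ (serreIter M ∂ E₄ kk (suc j) x)
  + ι (K.fromℕ (suc j) K.* (K.fromℕ (suc j) K.+ kk K.- K.1#)) * E₄ * serreIter M ∂ E₄ kk j x
  where open GradedAlgebra M
        module K where
          open Field K public
          open RingOps commutativeRing public

iter : ∀ {a} {A : Set a} → (A → A) → ℕ → A → A
iter f zero    x = x
iter f (suc j) x = f (iter f j x)

coeff : ∀ {k kℓ} (K : Field k kℓ) → (kk : Field.Carrier K) → ℕ → ℕ → Field.Carrier K
coeff K kk n j =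
  pow (- 1#) (n ∸ j) * fromℕ ((n !) ℕ./ ((n ∸ j) ! ℕ.* j !))
                     * poch (kk + fromℕ j) (n ∸ j)
  where open Field K
        open RingOps commutativeRing
        instance _ = (n ∸ j) !* j !≢0

record IsScriptD {k kℓ} {K : Field k kℓ} (char0 : CharZero K) {N} (N>0 : 0 ℕ.< N)
       {m mℓ h} {M : GradedAlgebra K N m mℓ h}
       (∂ : GradedAlgebra.Carrier M → GradedAlgebra.Carrier M)
       (E₄ : GradedAlgebra.Carrier M)
       {t tℓ} (M̃ : PolynomialExtension M t tℓ)
       (𝒟 : PolynomialExtension.Carrier M̃ → PolynomialExtension.Carrier M̃)
       : Set (k ⊔ m ⊔ h ⊔ t ⊔ tℓ) where
  private module M = GradedAlgebra M
  open PolynomialExtension M̃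
  field
    𝒟-cong    : ∀ {x y} → x ≈ y → 𝒟 x ≈ 𝒟 y
    𝒟-+       : ∀ x y → 𝒟 (x + y) ≈ 𝒟 x + 𝒟 y
    𝒟-·       : ∀ c x → 𝒟 (incl (M.ι c) * x) ≈ incl (M.ι c) * 𝒟 x
    𝒟-leibniz : ∀ x y → 𝒟 (x * y) ≈ x * 𝒟 y + 𝒟 x * y
    𝒟-M       : ∀ {a f} → M.Hom a f →
                𝒟 (incl f) ≈ incl (∂ f) + incl (M.ι (degree K char0 N N>0 a)) * E₂ * incl f
    𝒟-E₂      : 𝒟 E₂ ≈ incl E₄ + E₂ * E₂

module Submission where

-- Inside M̃ the derivation ∂ acts on M_k as ϑ_k y = 𝒟 y - k E₂ y, so the recursion defining
-- ∂₍ₙ₎ f reads ∂₍ₙ₊₂₎ f = ϑ_{k+2n+2} (∂₍ₙ₊₁₎ f) + (n+1)(n+k) E₄ ∂₍ₙ₎ f.  Write the right-hand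
-- side of the theorem as the diagonal sum Σ_{j+d=n} c(j,d) E₂^d 𝒟^j f, where
-- c(j,d) = (-1)^d C(j+d,d) (k+j)_d.  Since 𝒟 E₂ = E₄ + E₂², applying ϑ_w to such a sum gives
-- one part with j raised by one, one part with d raised by one and coefficients multiplied by
-- (d - w), and E₄ times the sum with coefficients (d+1) c(j,d+1).  For these c the first two
-- parts recombine to c (Pascal's rule and binomial absorption) and the E₄ part cancels the E₄
-- term of the recursion (absorption again), so both sides obey the same recursion.

open import Defs
open import Level using (Level; _⊔_)
open import Data.Nat as ℕ using (ℕ; zero; suc; _∸_; _<_; _!)
import Data.Nat.Properties as ℕ
open import Data.Nat.Combinatorics
  using (_C_; nCk≡n!/k![n-k]!; k![n∸k]!∣n!; nCn≡1; nCk+nC[k+1]≡[n+1]C[k+1])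
open import Data.Nat.DivMod using (_/_; m/n*n≡m; m*n/n≡m)
open import Data.Nat.Tactic.RingSolver using (solve-∀)
open import Data.Integer as ℤ using (ℤ; +_; -[1+_]; _⊖_)
import Data.Integer.Properties as ℤ
import Data.Sign as Sign
open import Data.Maybe using (Maybe; just; nothing)
open import Function using (_∘_)
open import Relation.Nullary using (yes; no)
open import Relation.Binary.PropositionalEquality as ≡ using (_≡_)
open import Algebra.Bundles using (CommutativeRing)
open import Algebra.Morphism.Structures using (IsRingHomomorphism)
open import Algebra.Morphism.Construct.Composition using (isRingHomomorphism)
open import Algebra.Solver.Ring.AlmostCommutativeRing
  using (fromCommutativeRing; _-Raw-AlmostCommutative⟶_)
import Algebra.Solver.Ring

[j+d]Cd*[d!*j!]≡[j+d]! : ∀ j d → ((j ℕ.+ d) C d) ℕ.* (d ! ℕ.* j !) ≡ (j ℕ.+ d) !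
[j+d]Cd*[d!*j!]≡[j+d]! j d = begin
  (n C d) ℕ.* (d ! ℕ.* j !)
    ≡⟨ ≡.cong (λ i → (n C d) ℕ.* (d ! ℕ.* i !)) (ℕ.m+n∸n≡m j d) ⟨
  (n C d) ℕ.* (d ! ℕ.* (n ∸ d) !)
    ≡⟨ ≡.cong (ℕ._* (d ! ℕ.* (n ∸ d) !)) (nCk≡n!/k![n-k]! d≤n) ⟩
  (n ! / (d ! ℕ.* (n ∸ d) !)) ℕ.* (d ! ℕ.* (n ∸ d) !)
    ≡⟨ m/n*n≡m (k![n∸k]!∣n! d≤n) ⟩
  n ! ∎
  where
  open ≡.≡-Reasoning
  n = j ℕ.+ d
  d≤n : d ℕ.≤ n
  d≤n = ℕ.m≤n+m d j
  instance _ = ℕ._!*_!≢0 d (n ∸ d)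

[j+d]!/[d!*j!]≡[j+d]Cd : ∀ j d → ((j ℕ.+ d) ! / (d ! ℕ.* j !)) {{ℕ._!*_!≢0 d j}} ≡ (j ℕ.+ d) C d
[j+d]!/[d!*j!]≡[j+d]Cd j d = begin
  (j ℕ.+ d) ! / (d ! ℕ.* j !)                             ≡⟨ ≡.cong (_/ (d ! ℕ.* j !)) ([j+d]Cd*[d!*j!]≡[j+d]! j d) ⟨
  (((j ℕ.+ d) C d) ℕ.* (d ! ℕ.* j !)) / (d ! ℕ.* j !)       ≡⟨ m*n/n≡m ((j ℕ.+ d) C d) (d ! ℕ.* j !) ⟩
  (j ℕ.+ d) C d                                           ∎
  where
  open ≡.≡-Reasoning
  instance _ = ℕ._!*_!≢0 d j

[1+j+d]!≡[1+j+d]*[j+d]Cd*[d!*j!] : ∀ j d →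
  suc (j ℕ.+ d) ! ≡ suc (j ℕ.+ d) ℕ.* ((j ℕ.+ d) C d) ℕ.* (d ! ℕ.* j !)
[1+j+d]!≡[1+j+d]*[j+d]Cd*[d!*j!] j d = begin
  suc (j ℕ.+ d) ℕ.* (j ℕ.+ d) !
    ≡⟨ ≡.cong (suc (j ℕ.+ d) ℕ.*_) ([j+d]Cd*[d!*j!]≡[j+d]! j d) ⟨
  suc (j ℕ.+ d) ℕ.* (((j ℕ.+ d) C d) ℕ.* (d ! ℕ.* j !))
    ≡⟨ ℕ.*-assoc (suc (j ℕ.+ d)) ((j ℕ.+ d) C d) (d ! ℕ.* j !) ⟨
  suc (j ℕ.+ d) ℕ.* ((j ℕ.+ d) C d) ℕ.* (d ! ℕ.* j !) ∎
  where open ≡.≡-Reasoning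

[1+d]*[j+1+d]C[1+d]≡[1+j+d]*[j+d]Cd : ∀ j d →
  suc d ℕ.* ((j ℕ.+ suc d) C suc d) ≡ suc (j ℕ.+ d) ℕ.* ((j ℕ.+ d) C d)
[1+d]*[j+1+d]C[1+d]≡[1+j+d]*[j+d]Cd j d = ℕ.*-cancelʳ-≡ _ _ (d ! ℕ.* j !) {{ℕ._!*_!≢0 d j}} (begin
  suc d ℕ.* X ℕ.* (d ! ℕ.* j !)                       ≡⟨ rearrange (suc d) X (d !) (j !) ⟩
  X ℕ.* (suc d ℕ.* d ! ℕ.* j !)                       ≡⟨ [j+d]Cd*[d!*j!]≡[j+d]! j (suc d) ⟩
  (j ℕ.+ suc d) !                                     ≡⟨ ≡.cong _! (ℕ.+-suc j d) ⟩
  suc (j ℕ.+ d) !                                     ≡⟨ [1+j+d]!≡[1+j+d]*[j+d]Cd*[d!*j!] j d ⟩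
  suc (j ℕ.+ d) ℕ.* ((j ℕ.+ d) C d) ℕ.* (d ! ℕ.* j !) ∎)
  where
  open ≡.≡-Reasoning
  X = (j ℕ.+ suc d) C suc d
  rearrange : ∀ a x y z → a ℕ.* x ℕ.* (y ℕ.* z) ≡ x ℕ.* (a ℕ.* y ℕ.* z)
  rearrange = solve-∀

[1+j]*[1+j+d]Cd≡[1+j+d]*[j+d]Cd : ∀ j d →
  suc j ℕ.* ((suc j ℕ.+ d) C d) ≡ suc (j ℕ.+ d) ℕ.* ((j ℕ.+ d) C d)
[1+j]*[1+j+d]Cd≡[1+j+d]*[j+d]Cd j d = ℕ.*-cancelʳ-≡ _ _ (d ! ℕ.* j !) {{ℕ._!*_!≢0 d j}} (begin
  suc j ℕ.* X ℕ.* (d ! ℕ.* j !)                       ≡⟨ rearrange (suc j) X (d !) (j !) ⟩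
  X ℕ.* (d ! ℕ.* (suc j ℕ.* j !))                     ≡⟨ [j+d]Cd*[d!*j!]≡[j+d]! (suc j) d ⟩
  suc (j ℕ.+ d) !                                     ≡⟨ [1+j+d]!≡[1+j+d]*[j+d]Cd*[d!*j!] j d ⟩
  suc (j ℕ.+ d) ℕ.* ((j ℕ.+ d) C d) ℕ.* (d ! ℕ.* j !) ∎)
  where
  open ≡.≡-Reasoning
  X = (suc j ℕ.+ d) C d
  rearrange : ∀ a x y z → a ℕ.* x ℕ.* (y ℕ.* z) ≡ x ℕ.* (y ℕ.* (a ℕ.* z))
  rearrange = solve-∀

[1+d]*[j+1+d]C[1+d]≡[1+j]*[j+1+d]Cd : ∀ j d →
  suc d ℕ.* ((j ℕ.+ suc d) C suc d) ≡ suc j ℕ.* ((j ℕ.+ suc d) C d)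
[1+d]*[j+1+d]C[1+d]≡[1+j]*[j+1+d]Cd j d = begin
  suc d ℕ.* ((j ℕ.+ suc d) C suc d)  ≡⟨ [1+d]*[j+1+d]C[1+d]≡[1+j+d]*[j+d]Cd j d ⟩
  suc (j ℕ.+ d) ℕ.* ((j ℕ.+ d) C d)  ≡⟨ [1+j]*[1+j+d]Cd≡[1+j+d]*[j+d]Cd j d ⟨
  suc j ℕ.* ((suc j ℕ.+ d) C d)      ≡⟨ ≡.cong (λ n → suc j ℕ.* (n C d)) (ℕ.+-suc j d) ⟨
  suc j ℕ.* ((j ℕ.+ suc d) C d)      ∎
  where open ≡.≡-Reasoning

+[4*n]+i≡i+[2*n]+[2*n] : ∀ n i → + (4 ℕ.* n) ℤ.+ i ≡ i ℤ.+ + (2 ℕ.* n) ℤ.+ + (2 ℕ.* n)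
+[4*n]+i≡i+[2*n]+[2*n] n i = begin
  + (4 ℕ.* n) ℤ.+ i                        ≡⟨ ℤ.+-comm (+ (4 ℕ.* n)) i ⟩
  i ℤ.+ + ((2 ℕ.+ 2) ℕ.* n)                ≡⟨ ≡.cong (λ m → i ℤ.+ + m) (ℕ.*-distribʳ-+ n 2 2) ⟩
  i ℤ.+ + (2 ℕ.* n ℕ.+ 2 ℕ.* n)            ≡⟨ ≡.cong (ℤ._+_ i) (ℤ.pos-+ (2 ℕ.* n) (2 ℕ.* n)) ⟩
  i ℤ.+ (+ (2 ℕ.* n) ℤ.+ + (2 ℕ.* n))      ≡⟨ ℤ.+-assoc i _ _ ⟨
  i ℤ.+ + (2 ℕ.* n) ℤ.+ + (2 ℕ.* n)        ∎
  where open ≡.≡-Reasoning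

module RingOpsProperties {c ℓ} (R : CommutativeRing c ℓ) where
  open CommutativeRing R hiding (zero)
  open RingOps R
  open import Algebra.Properties.Semiring.Mult semiring using (_×_; ×-homo-+; ×1-homo-*)
  open import Algebra.Properties.Ring ring using (-‿distribˡ-*; -‿distribʳ-*)
  open import Algebra.Properties.AbelianGroup +-abelianGroup using (⁻¹-∙-comm)
  open import Algebra.Properties.Group +-group using (⁻¹-involutive; ε⁻¹≈ε)
  open import Algebra.Properties.CommutativeSemigroup +-commutativeSemigroup using (interchange)
  open import Relation.Binary.Reasoning.Setoid setoid

  ×1≡fromℕ : ∀ n → n × 1# ≡ fromℕ n
  ×1≡fromℕ zero    = ≡.refl
  ×1≡fromℕ (suc n) = ≡.cong (λ x → 1# + x) (×1≡fromℕ n)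

  fromℕ-cong : ∀ {m n} → m ≡ n → fromℕ m ≈ fromℕ n
  fromℕ-cong = reflexive ∘ ≡.cong fromℕ

  fromℕ-+ : ∀ m n → fromℕ (m ℕ.+ n) ≈ fromℕ m + fromℕ n
  fromℕ-+ m n rewrite ≡.sym (×1≡fromℕ (m ℕ.+ n)) | ≡.sym (×1≡fromℕ m) | ≡.sym (×1≡fromℕ n) =
    ×-homo-+ 1# m n

  fromℕ-* : ∀ m n → fromℕ (m ℕ.* n) ≈ fromℕ m * fromℕ n
  fromℕ-* m n rewrite ≡.sym (×1≡fromℕ (m ℕ.* n)) | ≡.sym (×1≡fromℕ m) | ≡.sym (×1≡fromℕ n) =
    ×1-homo-* m n

  fromℕ-*-≡ : ∀ a b c d → a ℕ.* b ≡ c ℕ.* d → fromℕ a * fromℕ b ≈ fromℕ c * fromℕ d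
  fromℕ-*-≡ a b c d ab≡cd = trans (sym (fromℕ-* a b)) (trans (fromℕ-cong ab≡cd) (fromℕ-* c d))

  fromℤ-⊖ : ∀ m n → fromℤ (m ⊖ n) ≈ fromℕ m - fromℕ n
  fromℤ-⊖ m       zero    = begin
    fromℤ (m ⊖ 0)    ≡⟨ ≡.cong fromℤ (ℤ.⊖-≥ {m} ℕ.z≤n) ⟩
    fromℕ m          ≈⟨ +-identityʳ _ ⟨
    fromℕ m + 0#     ≈⟨ +-congˡ ε⁻¹≈ε ⟨
    fromℕ m - 0#     ∎
  fromℤ-⊖ zero    (suc n) = sym (+-identityˡ _)
  fromℤ-⊖ (suc m) (suc n) = begin
    fromℤ (suc m ⊖ suc n)             ≡⟨ ≡.cong fromℤ (ℤ.[1+m]⊖[1+n]≡m⊖n m n) ⟩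
    fromℤ (m ⊖ n)                     ≈⟨ fromℤ-⊖ m n ⟩
    fromℕ m - fromℕ n                 ≈⟨ +-identityˡ _ ⟨
    0# + (fromℕ m - fromℕ n)          ≈⟨ +-congʳ (-‿inverseʳ 1#) ⟨
    (1# - 1#) + (fromℕ m - fromℕ n)   ≈⟨ interchange 1# (- 1#) (fromℕ m) (- fromℕ n) ⟩
    (1# + fromℕ m) + (- 1# - fromℕ n) ≈⟨ +-congˡ (⁻¹-∙-comm 1# (fromℕ n)) ⟩
    (1# + fromℕ m) - (1# + fromℕ n)   ∎

  fromℤ-+ : ∀ i j → fromℤ (i ℤ.+ j) ≈ fromℤ i + fromℤ j
  fromℤ-+ (+ m)    (+ n)    = fromℕ-+ m n
  fromℤ-+ (+ m)    -[1+ n ] = fromℤ-⊖ m (suc n)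
  fromℤ-+ -[1+ m ] (+ n)    = trans (fromℤ-⊖ n (suc m)) (+-comm _ _)
  fromℤ-+ -[1+ m ] -[1+ n ] = begin
    - fromℕ (suc (suc (m ℕ.+ n)))     ≡⟨ ≡.cong (λ k → - fromℕ (suc k)) (ℕ.+-suc m n) ⟨
    - fromℕ (suc m ℕ.+ suc n)         ≈⟨ -‿cong (fromℕ-+ (suc m) (suc n)) ⟩
    - (fromℕ (suc m) + fromℕ (suc n)) ≈⟨ ⁻¹-∙-comm _ _ ⟨
    - fromℕ (suc m) - fromℕ (suc n)   ∎

  fromℤ-neg : ∀ i → fromℤ (ℤ.- i) ≈ - fromℤ i
  fromℤ-neg (+ zero)  = sym ε⁻¹≈ε
  fromℤ-neg (+ suc n) = refl
  fromℤ-neg -[1+ n ]  = sym (⁻¹-involutive _)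

  fromℤ-[+◃] : ∀ n → fromℤ (Sign.+ ℤ.◃ n) ≈ fromℕ n
  fromℤ-[+◃] zero    = refl
  fromℤ-[+◃] (suc n) = refl

  fromℤ-[-◃] : ∀ n → fromℤ (Sign.- ℤ.◃ n) ≈ - fromℕ n
  fromℤ-[-◃] zero    = sym ε⁻¹≈ε
  fromℤ-[-◃] (suc n) = refl

  fromℤ-* : ∀ i j → fromℤ (i ℤ.* j) ≈ fromℤ i * fromℤ j
  fromℤ-* (+ m)    (+ n)    = trans (fromℤ-[+◃] (m ℕ.* n)) (fromℕ-* m n)
  fromℤ-* (+ m)    -[1+ n ] =
    trans (fromℤ-[-◃] (m ℕ.* suc n)) (trans (-‿cong (fromℕ-* m (suc n))) (-‿distribʳ-* _ _))
  fromℤ-* -[1+ m ] (+ n)    =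
    trans (fromℤ-[-◃] (suc m ℕ.* n)) (trans (-‿cong (fromℕ-* (suc m) n)) (-‿distribˡ-* _ _))
  fromℤ-* -[1+ m ] -[1+ n ] = begin
    fromℤ (Sign.+ ℤ.◃ (suc m ℕ.* suc n)) ≈⟨ fromℤ-[+◃] (suc m ℕ.* suc n) ⟩
    fromℕ (suc m ℕ.* suc n)             ≈⟨ fromℕ-* (suc m) (suc n) ⟩
    x * y                               ≈⟨ ⁻¹-involutive _ ⟨
    - - (x * y)                         ≈⟨ -‿cong (-‿distribʳ-* x y) ⟩
    - (x * - y)                         ≈⟨ -‿distribˡ-* x (- y) ⟩
    - x * - y                           ∎
    where x = fromℕ (suc m); y = fromℕ (suc n)

  fromℤ-morphism : ℤ.+-*-rawRing -Raw-AlmostCommutative⟶ fromCommutativeRing R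
  fromℤ-morphism = record
    { ⟦_⟧    = fromℤ
    ; +-homo = fromℤ-+
    ; *-homo = fromℤ-*
    ; -‿homo = fromℤ-neg
    ; 0-homo = refl
    ; 1-homo = +-identityʳ 1#
    }

  fromℤ-≟ : ∀ i j → Maybe (fromℤ i ≈ fromℤ j)
  fromℤ-≟ i j with i ℤ.≟ j
  ... | yes i≡j = just (reflexive (≡.cong fromℤ i≡j))
  ... | no _    = nothing

  module Solver = Algebra.Solver.Ring ℤ.+-*-rawRing (fromCommutativeRing R) fromℤ-morphism fromℤ-≟
  open Solver using (Polynomial; con; _:^_; solve; _:=_; _:+_; _:*_)

  -- The solver reads a constant con i as fromℤ i, so con (+ 1) is 1# + 0#; the unit 1# itself is
  -- written as an empty power.
  𝟙 : ∀ {n} → Polynomial n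
  𝟙 = con (+ 0) :^ 0

  poch-cong : ∀ {x y} d → x ≈ y → poch x d ≈ poch y d
  poch-cong zero    x≈y = refl
  poch-cong (suc d) x≈y = *-cong (poch-cong d x≈y) (+-congʳ x≈y)

  poch-suc : ∀ x d → poch x (suc d) ≈ x * poch (x + 1#) d
  poch-suc x zero    = solve 1 (λ x → 𝟙 :* (x :+ con (+ 0)) := x :* 𝟙) refl x
  poch-suc x (suc d) = begin
    poch x (suc d) * (x + fromℕ (suc d))          ≈⟨ *-congʳ (poch-suc x d) ⟩
    x * poch (x + 1#) d * (x + (1# + fromℕ d))
      ≈⟨ solve 3 (λ x p n → x :* p :* (x :+ (𝟙 :+ n)) := x :* (p :* ((x :+ 𝟙) :+ n))) refl x (poch (x + 1#) d) (fromℕ d) ⟩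
    x * (poch (x + 1#) d * ((x + 1#) + fromℕ d))  ∎

module _ {k kℓ} (K : Field k kℓ) (char0 : CharZero K) where
  open Field K
  open RingOps commutativeRing
  open RingOpsProperties commutativeRing using (fromℕ-*; fromℤ-+)
  open import Relation.Binary.Reasoning.Setoid setoid

  degree-+ : ∀ {N} (N>0 : 0 < N) i n →
             degree K char0 N N>0 (i ℤ.+ + (n ℕ.* N)) ≈ degree K char0 N N>0 i + fromℕ n
  degree-+ {N} N>0 i n = begin
    fromℤ (i ℤ.+ + (n ℕ.* N)) * N⁻¹            ≈⟨ *-congʳ (fromℤ-+ i (+ (n ℕ.* N))) ⟩
    (fromℤ i + fromℕ (n ℕ.* N)) * N⁻¹          ≈⟨ distribʳ N⁻¹ _ _ ⟩
    fromℤ i * N⁻¹ + fromℕ (n ℕ.* N) * N⁻¹      ≈⟨ +-congˡ (*-congʳ (fromℕ-* n N)) ⟩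
    fromℤ i * N⁻¹ + fromℕ n * fromℕ N * N⁻¹    ≈⟨ +-congˡ (*-assoc _ _ _) ⟩
    fromℤ i * N⁻¹ + fromℕ n * (fromℕ N * N⁻¹)  ≈⟨ +-congˡ (*-congˡ (inv-r _ N≉0)) ⟩
    fromℤ i * N⁻¹ + fromℕ n * 1#               ≈⟨ +-congˡ (*-identityʳ _) ⟩
    fromℤ i * N⁻¹ + fromℕ n                    ∎
    where
    N≉0 = char0 N (ℕ.n>0⇒n≢0 N>0)
    N⁻¹ = inv (fromℕ N) N≉0

shift₁ shift₂ : ∀ {a} {A : Set a} → A → (ℕ → ℕ → A) → ℕ → ℕ → A
shift₁ z g zero    d = z
shift₁ z g (suc j) d = g j d
shift₂ z g j zero    = z
shift₂ z g j (suc d) = g j d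

module SerreCoefficients {c ℓ} (K : CommutativeRing c ℓ) (κ : CommutativeRing.Carrier K) where
  open CommutativeRing K hiding (zero)
  open RingOps K
  open RingOpsProperties K
  open Solver
  open import Algebra.Properties.Group +-group using (x≈y⇒x∙y⁻¹≈ε)
  open import Relation.Binary.Reasoning.Setoid setoid

  -- The coefficient of E₂^d 𝒟^j f in ∂₍ⱼ₊d₎ f.
  serreCoeff : ℕ → ℕ → Carrier
  serreCoeff j d = pow (- 1#) d * fromℕ ((j ℕ.+ d) C d) * poch (κ + fromℕ j) d

  weight : ℕ → Carrier
  weight m = κ + fromℕ (2 ℕ.* m)

  E₄Coeff : ℕ → Carrier
  E₄Coeff n = fromℕ (suc n) * (fromℕ (suc n) + κ - 1#)

  weight-suc : ∀ m → weight m + fromℕ 2 ≈ weight (suc m)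
  weight-suc m = begin
    κ + fromℕ (2 ℕ.* m) + fromℕ 2    ≈⟨ +-assoc κ _ _ ⟩
    κ + (fromℕ (2 ℕ.* m) + fromℕ 2)  ≈⟨ +-congˡ (fromℕ-+ (2 ℕ.* m) 2) ⟨
    κ + fromℕ (2 ℕ.* m ℕ.+ 2)        ≡⟨ ≡.cong (λ n → κ + fromℕ n) 2m+2≡2[1+m] ⟩
    κ + fromℕ (2 ℕ.* suc m)          ∎
    where
    2m+2≡2[1+m] : 2 ℕ.* m ℕ.+ 2 ≡ 2 ℕ.* suc m
    2m+2≡2[1+m] = ≡.trans (ℕ.+-comm (2 ℕ.* m) 2) (≡.sym (ℕ.*-suc 2 m))

  serreCoeff-zeroʳ : ∀ j → serreCoeff j 0 ≈ 1#
  serreCoeff-zeroʳ j = solve 0 (𝟙 :* con (+ 1) :* 𝟙 := 𝟙) refl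

  serreCoeff-E₄ : ∀ j d → fromℕ (suc d) * serreCoeff j (suc d) + E₄Coeff (j ℕ.+ d) * serreCoeff j d ≈ 0#
  serreCoeff-E₄ j d = begin
    (1# + D) * (- 1# * σ * A * (P * ((κ + J) + D))) + (1# + N) * ((1# + N) + κ - 1#) * (σ * B * P)
      ≈⟨ solve 8 (λ σ P J D N A B k →
             (𝟙 :+ D) :* (:- 𝟙 :* σ :* A :* (P :* ((k :+ J) :+ D))) :+ (𝟙 :+ N) :* ((𝟙 :+ N) :+ k :- 𝟙) :* (σ :* B :* P)
          := σ :* P :* ((𝟙 :+ N) :* B :* (N :- (J :+ D)) :+ ((𝟙 :+ N) :* B :- (𝟙 :+ D) :* A) :* ((k :+ J) :+ D)))
          refl σ P J D N A B κ ⟩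
    σ * P * ((1# + N) * B * (N - (J + D)) + ((1# + N) * B - (1# + D) * A) * ((κ + J) + D))
      ≈⟨ *-congˡ (+-cong (*-congˡ (x≈y⇒x∙y⁻¹≈ε (fromℕ-+ j d)))
                         (*-congʳ (x≈y⇒x∙y⁻¹≈ε (sym absorption)))) ⟩
    σ * P * ((1# + N) * B * 0# + 0# * ((κ + J) + D))
      ≈⟨ solve 5 (λ σ P N B s → σ :* P :* ((𝟙 :+ N) :* B :* con (+ 0) :+ con (+ 0) :* s) := con (+ 0))
           refl σ P N B ((κ + J) + D) ⟩
    0# ∎
    where
    σ = pow (- 1#) d
    P = poch (κ + fromℕ j) d
    J = fromℕ j
    D = fromℕ d
    N = fromℕ (j ℕ.+ d)
    A = fromℕ ((j ℕ.+ suc d) C suc d)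
    B = fromℕ ((j ℕ.+ d) C d)
    absorption : (1# + D) * A ≈ (1# + N) * B
    absorption = fromℕ-*-≡ (suc d) ((j ℕ.+ suc d) C suc d) (suc (j ℕ.+ d)) ((j ℕ.+ d) C d)
                             ([1+d]*[j+1+d]C[1+d]≡[1+j+d]*[j+d]Cd j d)

  serreCoeff-sucʳ : ∀ j d →
    serreCoeff j (suc d) ≈ shift₁ 0# serreCoeff j (suc d) + (fromℕ d - weight (j ℕ.+ d)) * serreCoeff j d
  serreCoeff-sucʳ zero d = begin
    - 1# * σ * fromℕ (suc d C suc d) * (P * ((κ + 0#) + D))
      ≈⟨ *-congʳ (*-congˡ (fromℕ-cong (nCn≡1 (suc d)))) ⟩
    - 1# * σ * fromℕ 1 * (P * ((κ + 0#) + D))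
      ≈⟨ solve 4 (λ σ P D k → :- 𝟙 :* σ :* con (+ 1) :* (P :* ((k :+ con (+ 0)) :+ D))
                            := con (+ 0) :+ (D :- (k :+ con (+ 2) :* D)) :* (σ :* con (+ 1) :* P))
           refl σ P D κ ⟩
    0# + (D - (κ + fromℕ 2 * D)) * (σ * fromℕ 1 * P)
      ≈⟨ +-congˡ (*-cong (+-congˡ (-‿cong (+-congˡ (fromℕ-* 2 d)))) (*-congʳ (*-congˡ (fromℕ-cong (nCn≡1 d))))) ⟨
    0# + (D - weight d) * serreCoeff 0 d ∎
    where
    σ = pow (- 1#) d
    P = poch (κ + 0#) d
    D = fromℕ d
  serreCoeff-sucʳ (suc j) d = begin
    serreCoeff (suc j) (suc d)
      ≈⟨ *-congʳ (*-congˡ pascal) ⟩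
    - 1# * σ * (B + A) * (P * ((κ + (1# + J)) + D))
      ≈⟨ solve 7 (λ σ P J D A B k →
             :- 𝟙 :* σ :* (B :+ A) :* (P :* ((k :+ (𝟙 :+ J)) :+ D))
          := (:- 𝟙 :* σ :* A :* ((k :+ J) :* P) :+ (D :- (k :+ con (+ 2) :* (𝟙 :+ (J :+ D)))) :* (σ :* B :* P))
             :+ :- 𝟙 :* σ :* P :* ((𝟙 :+ D) :* A :- (𝟙 :+ J) :* B))
          refl σ P J D A B κ ⟩
    rhs + - 1# * σ * P * ((1# + D) * A - (1# + J) * B)
      ≈⟨ +-congˡ (trans (*-congˡ (x≈y⇒x∙y⁻¹≈ε absorption)) (zeroʳ _)) ⟩
    rhs + 0#
      ≈⟨ +-identityʳ rhs ⟩
    rhs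
      ≈⟨ +-cong (*-congˡ poch-step) (*-cong (+-congˡ (-‿cong (+-congˡ twice))) (*-congʳ (*-congˡ shifted))) ⟨
    serreCoeff j (suc d) + (D - weight (suc j ℕ.+ d)) * serreCoeff (suc j) d ∎
    where
    σ = pow (- 1#) d
    P = poch (κ + fromℕ (suc j)) d
    J = fromℕ j
    D = fromℕ d
    A = fromℕ ((j ℕ.+ suc d) C suc d)
    B = fromℕ ((j ℕ.+ suc d) C d)
    rhs = - 1# * σ * A * ((κ + J) * P) + (D - (κ + fromℕ 2 * (1# + (J + D)))) * (σ * B * P)
    pascal : fromℕ ((suc j ℕ.+ suc d) C suc d) ≈ B + A
    pascal = trans (fromℕ-cong (≡.sym (nCk+nC[k+1]≡[n+1]C[k+1] (j ℕ.+ suc d) d)))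
                   (fromℕ-+ ((j ℕ.+ suc d) C d) ((j ℕ.+ suc d) C suc d))
    absorption : (1# + D) * A ≈ (1# + J) * B
    absorption = fromℕ-*-≡ (suc d) ((j ℕ.+ suc d) C suc d) (suc j) ((j ℕ.+ suc d) C d)
                             ([1+d]*[j+1+d]C[1+d]≡[1+j]*[j+1+d]Cd j d)
    poch-step : poch (κ + J) (suc d) ≈ (κ + J) * P
    poch-step = trans (poch-suc (κ + J) d) (*-congˡ (poch-cong d (trans (+-assoc κ J 1#) (+-congˡ (+-comm J 1#)))))
    twice : fromℕ (2 ℕ.* suc (j ℕ.+ d)) ≈ fromℕ 2 * (1# + (J + D))
    twice = trans (fromℕ-* 2 (suc (j ℕ.+ d))) (*-congˡ (+-congˡ (fromℕ-+ j d)))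
    shifted : fromℕ ((suc j ℕ.+ d) C d) ≈ B
    shifted = fromℕ-cong (≡.cong (_C d) (≡.sym (ℕ.+-suc j d)))

  serreCoeff-rec : ∀ m j d → j ℕ.+ d ≡ suc m →
    serreCoeff j d ≈ shift₁ 0# serreCoeff j d + shift₂ 0# (λ j d → (fromℕ d - weight m) * serreCoeff j d) j d
  serreCoeff-rec m zero    zero    ()
  serreCoeff-rec m (suc j) zero    _  = begin
    serreCoeff (suc j) 0  ≈⟨ serreCoeff-zeroʳ (suc j) ⟩
    1#                    ≈⟨ serreCoeff-zeroʳ j ⟨
    serreCoeff j 0        ≈⟨ +-identityʳ _ ⟨
    serreCoeff j 0 + 0#   ∎
  serreCoeff-rec m j       (suc d) j+d+1≡m+1 =
    ≡.subst (λ m → serreCoeff j (suc d) ≈ shift₁ 0# serreCoeff j (suc d) + (fromℕ d - weight m) * serreCoeff j d)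
            (ℕ.suc-injective (≡.trans (≡.sym (ℕ.+-suc j d)) j+d+1≡m+1))
            (serreCoeff-sucʳ j d)

module DiagonalSums {c ℓ} (R : CommutativeRing c ℓ) where
  open CommutativeRing R hiding (zero)
  open RingOps R
  open import Algebra.Properties.CommutativeSemigroup +-commutativeSemigroup using (interchange)
  open import Relation.Binary.Reasoning.Setoid setoid

  sumDiag : ℕ → (ℕ → ℕ → Carrier) → Carrier
  sumDiag zero    g = g 0 0
  sumDiag (suc n) g = g 0 (suc n) + sumDiag n (λ j d → g (suc j) d)

  sumDiag-cong : ∀ n {g h : ℕ → ℕ → Carrier} → (∀ j d → j ℕ.+ d ≡ n → g j d ≈ h j d) →
                 sumDiag n g ≈ sumDiag n h
  sumDiag-cong zero    g≈h = g≈h 0 0 ≡.refl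
  sumDiag-cong (suc n) g≈h =
    +-cong (g≈h 0 (suc n) ≡.refl) (sumDiag-cong n (λ j d eq → g≈h (suc j) d (≡.cong suc eq)))

  sumDiag-≈0 : ∀ n {g : ℕ → ℕ → Carrier} → (∀ j d → j ℕ.+ d ≡ n → g j d ≈ 0#) → sumDiag n g ≈ 0#
  sumDiag-≈0 zero    g≈0 = g≈0 0 0 ≡.refl
  sumDiag-≈0 (suc n) g≈0 = trans
    (+-cong (g≈0 0 (suc n) ≡.refl) (sumDiag-≈0 n (λ j d eq → g≈0 (suc j) d (≡.cong suc eq))))
    (+-identityˡ 0#)

  sumDiag-+ : ∀ n (g h : ℕ → ℕ → Carrier) → sumDiag n (λ j d → g j d + h j d) ≈ sumDiag n g + sumDiag n h
  sumDiag-+ zero    g h = refl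
  sumDiag-+ (suc n) g h = trans (+-congˡ (sumDiag-+ n _ _)) (interchange _ _ _ _)

  sumDiag-homo : ∀ {f : Carrier → Carrier} → (∀ x y → f (x + y) ≈ f x + f y) →
                 ∀ n g → f (sumDiag n g) ≈ sumDiag n (λ j d → f (g j d))
  sumDiag-homo f-+ zero    g = refl
  sumDiag-homo f-+ (suc n) g = trans (f-+ _ _) (+-congˡ (sumDiag-homo f-+ n _))

  sumDiag-sucʳ : ∀ n g → sumDiag (suc n) g ≈ sumDiag n (λ j d → g j (suc d)) + g (suc n) 0
  sumDiag-sucʳ zero    g = refl
  sumDiag-sucʳ (suc n) g = trans (+-congˡ (sumDiag-sucʳ n (λ j d → g (suc j) d))) (sym (+-assoc _ _ _))

  sumTo-cong : ∀ n {f g : ℕ → Carrier} → (∀ j → j ℕ.≤ n → f j ≈ g j) → sumTo n f ≈ sumTo n g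
  sumTo-cong zero    f≈g = f≈g 0 ℕ.z≤n
  sumTo-cong (suc n) f≈g = +-cong (sumTo-cong n (λ j j≤n → f≈g j (ℕ.m≤n⇒m≤1+n j≤n))) (f≈g (suc n) ℕ.≤-refl)

  sumTo≈sumDiag : ∀ n g → sumTo n (λ j → g j (n ∸ j)) ≈ sumDiag n g
  sumTo≈sumDiag zero    g = refl
  sumTo≈sumDiag (suc n) g = begin
    sumTo n (λ j → g j (suc n ∸ j)) + g (suc n) (n ∸ n)
      ≈⟨ +-cong (sumTo-cong n (λ j j≤n → reflexive (≡.cong (g j) (ℕ.+-∸-assoc 1 j≤n))))
                (reflexive (≡.cong (g (suc n)) (ℕ.n∸n≡0 n))) ⟩
    sumTo n (λ j → g j (suc (n ∸ j))) + g (suc n) 0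
      ≈⟨ +-congʳ (sumTo≈sumDiag n (λ j d → g j (suc d))) ⟩
    sumDiag n (λ j d → g j (suc d)) + g (suc n) 0
      ≈⟨ sumDiag-sucʳ n g ⟨
    sumDiag (suc n) g ∎

record IsLinearDerivation {k kℓ r rℓ} {K : CommutativeRing k kℓ} (R : CommutativeRing r rℓ)
       (φ : CommutativeRing.Carrier K → CommutativeRing.Carrier R)
       (𝒟 : CommutativeRing.Carrier R → CommutativeRing.Carrier R) : Set (k ⊔ r ⊔ rℓ) where
  open CommutativeRing R hiding (zero)
  open RingOps R
  field
    𝒟-cong    : ∀ {x y} → x ≈ y → 𝒟 x ≈ 𝒟 y
    𝒟-+       : ∀ x y → 𝒟 (x + y) ≈ 𝒟 x + 𝒟 y
    𝒟-·       : ∀ c x → 𝒟 (φ c * x) ≈ φ c * 𝒟 x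
    𝒟-leibniz : ∀ x y → 𝒟 (x * y) ≈ x * 𝒟 y + 𝒟 x * y

  open RingOpsProperties R using (module Solver; 𝟙)
  open Solver
  open import Algebra.Properties.Ring ring using (x+x≈x⇒x≈0)
  open import Relation.Binary.Reasoning.Setoid setoid

  𝒟-1# : 𝒟 1# ≈ 0#
  𝒟-1# = x+x≈x⇒x≈0 (𝒟 1#) (begin
    𝒟 1# + 𝒟 1#             ≈⟨ +-cong (*-identityˡ _) (*-identityʳ _) ⟨
    1# * 𝒟 1# + 𝒟 1# * 1#   ≈⟨ 𝒟-leibniz 1# 1# ⟨
    𝒟 (1# * 1#)             ≈⟨ 𝒟-cong (*-identityˡ 1#) ⟩
    𝒟 1#                    ∎)

  𝒟-pow : ∀ y e → 𝒟 (pow y (suc e)) ≈ fromℕ (suc e) * (pow y e * 𝒟 y)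
  𝒟-pow y zero = begin
    𝒟 (y * 1#)            ≈⟨ 𝒟-leibniz y 1# ⟩
    y * 𝒟 1# + 𝒟 y * 1#   ≈⟨ +-congʳ (*-congˡ 𝒟-1#) ⟩
    y * 0# + 𝒟 y * 1#     ≈⟨ solve 2 (λ y y′ → y :* con (+ 0) :+ y′ :* 𝟙 := con (+ 1) :* (𝟙 :* y′))
                                     refl y (𝒟 y) ⟩
    fromℕ 1 * (1# * 𝒟 y)  ∎
  𝒟-pow y (suc e) = begin
    𝒟 (y * pow y (suc e))                                       ≈⟨ 𝒟-leibniz y _ ⟩
    y * 𝒟 (pow y (suc e)) + 𝒟 y * pow y (suc e)                 ≈⟨ +-congʳ (*-congˡ (𝒟-pow y e)) ⟩
    y * (fromℕ (suc e) * (pow y e * 𝒟 y)) + 𝒟 y * (y * pow y e)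
      ≈⟨ solve 4 (λ y y′ p n → y :* ((𝟙 :+ n) :* (p :* y′)) :+ y′ :* (y :* p)
                            := (𝟙 :+ (𝟙 :+ n)) :* ((y :* p) :* y′))
           refl y (𝒟 y) (pow y e) (fromℕ e) ⟩
    fromℕ (suc (suc e)) * (pow y (suc e) * 𝒟 y)                 ∎

module Expansion
  {k kℓ r rℓ} {K : CommutativeRing k kℓ} (R : CommutativeRing r rℓ)
  {φ : CommutativeRing.Carrier K → CommutativeRing.Carrier R}
  (φ-hom : IsRingHomomorphism (CommutativeRing.rawRing K) (CommutativeRing.rawRing R) φ)
  {𝒟 : CommutativeRing.Carrier R → CommutativeRing.Carrier R}
  (𝒟-der : IsLinearDerivation {K = K} R φ 𝒟)
  (E₂ E₄ : CommutativeRing.Carrier R)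
  (𝒟-E₂ : CommutativeRing._≈_ R (𝒟 E₂) (CommutativeRing._+_ R E₄ (CommutativeRing._*_ R E₂ E₂)))
  (x : CommutativeRing.Carrier R)
  where

  open CommutativeRing R hiding (zero)
  open RingOps R
  open RingOpsProperties R using (module Solver; 𝟙)
  open Solver
  open DiagonalSums R
  open IsLinearDerivation 𝒟-der
  open import Relation.Binary.Reasoning.Setoid setoid
  private
    module K where
      open CommutativeRing K public
      open RingOps K public
    module φ = IsRingHomomorphism φ-hom

  φ-fromℕ : ∀ n → φ (K.fromℕ n) ≈ fromℕ n
  φ-fromℕ zero    = φ.0#-homo
  φ-fromℕ (suc n) = trans (φ.+-homo _ _) (+-cong φ.1#-homo (φ-fromℕ n))

  φ-scale : ∀ n α → φ (K.fromℕ n K.* α) ≈ fromℕ n * φ α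
  φ-scale n α = trans (φ.*-homo (K.fromℕ n) α) (*-congʳ (φ-fromℕ n))

  φ-affine : ∀ n w α → φ ((K.fromℕ n K.- w) K.* α) ≈ (fromℕ n - φ w) * φ α
  φ-affine n w α =
    trans (φ.*-homo (K.fromℕ n K.- w) α) (*-congʳ (trans (φ.+-homo _ _) (+-cong (φ-fromℕ n) (φ.-‿homo w))))

  ϑ : K.Carrier → Carrier → Carrier
  ϑ w y = 𝒟 y - φ w * E₂ * y

  ϑ-cong : ∀ {w w′ y y′} → w K.≈ w′ → y ≈ y′ → ϑ w y ≈ ϑ w′ y′
  ϑ-cong w≈w′ y≈y′ = +-cong (𝒟-cong y≈y′) (-‿cong (*-cong (*-congʳ (φ.⟦⟧-cong w≈w′)) y≈y′))

  ϑ-+ : ∀ w y z → ϑ w (y + z) ≈ ϑ w y + ϑ w z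
  ϑ-+ w y z = begin
    𝒟 (y + z) - φ w * E₂ * (y + z)               ≈⟨ +-congʳ (𝒟-+ y z) ⟩
    (𝒟 y + 𝒟 z) - φ w * E₂ * (y + z)
      ≈⟨ solve 5 (λ y z y′ z′ c → (y′ :+ z′) :- c :* (y :+ z) := (y′ :- c :* y) :+ (z′ :- c :* z))
                 refl y z (𝒟 y) (𝒟 z) (φ w * E₂) ⟩
    (𝒟 y - φ w * E₂ * y) + (𝒟 z - φ w * E₂ * z)  ∎

  X : ℕ → Carrier
  X j = iter 𝒟 j x

  term : (ℕ → ℕ → K.Carrier) → ℕ → ℕ → Carrier
  term a j d = φ (a j d) * (pow E₂ d * X j)

  ⟪_⟫ : (ℕ → ℕ → K.Carrier) → ℕ → Carrier
  ⟪ a ⟫ n = sumDiag n (term a)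

  weighted : K.Carrier → (ℕ → ℕ → K.Carrier) → ℕ → ℕ → K.Carrier
  weighted w a j d = (K.fromℕ d K.- w) K.* a j d

  ϑ-coeff : K.Carrier → (ℕ → ℕ → K.Carrier) → ℕ → ℕ → K.Carrier
  ϑ-coeff w a j d = shift₁ K.0# a j d K.+ shift₂ K.0# (weighted w a) j d

  derivE₂ : (ℕ → ℕ → K.Carrier) → ℕ → ℕ → K.Carrier
  derivE₂ a j d = K.fromℕ (suc d) K.* a j (suc d)

  E₄-term : (ℕ → ℕ → K.Carrier) → ℕ → ℕ → Carrier
  E₄-term a = shift₂ 0# (λ j d → E₄ * term (derivE₂ a) j d)

  term-zero : ∀ a j d → a j d K.≈ K.0# → term a j d ≈ 0#
  term-zero a j d a≈0 = trans (*-congʳ (trans (φ.⟦⟧-cong a≈0) φ.0#-homo)) (zeroˡ _)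

  ⟪⟫-cong : ∀ n {a b} → (∀ j d → j ℕ.+ d ≡ n → a j d K.≈ b j d) → ⟪ a ⟫ n ≈ ⟪ b ⟫ n
  ⟪⟫-cong n a≈b = sumDiag-cong n (λ j d j+d≡n → *-congʳ (φ.⟦⟧-cong (a≈b j d j+d≡n)))

  ⟪⟫-≈0 : ∀ n {a} → (∀ j d → j ℕ.+ d ≡ n → a j d K.≈ K.0#) → ⟪ a ⟫ n ≈ 0#
  ⟪⟫-≈0 n {a} a≈0 = sumDiag-≈0 n (λ j d j+d≡n → term-zero a j d (a≈0 j d j+d≡n))

  ⟪⟫-+ : ∀ n a b → ⟪ (λ j d → a j d K.+ b j d) ⟫ n ≈ ⟪ a ⟫ n + ⟪ b ⟫ n
  ⟪⟫-+ n a b = trans (sumDiag-cong n (λ j d _ → trans (*-congʳ (φ.+-homo _ _)) (distribʳ _ _ _)))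
                     (sumDiag-+ n (term a) (term b))

  ⟪⟫-*ˡ : ∀ n r a → φ r * ⟪ a ⟫ n ≈ ⟪ (λ j d → r K.* a j d) ⟫ n
  ⟪⟫-*ˡ n r a = trans (sumDiag-homo (distribˡ (φ r)) n (term a))
                      (sumDiag-cong n (λ j d _ → trans (sym (*-assoc _ _ _)) (*-congʳ (sym (φ.*-homo r _)))))

  ⟪shift₁⟫ : ∀ n a → ⟪ shift₁ K.0# a ⟫ (suc n) ≈ sumDiag n (λ j d → term (shift₁ K.0# a) (suc j) d)
  ⟪shift₁⟫ n a = trans (+-congʳ (term-zero (shift₁ K.0# a) 0 (suc n) K.refl)) (+-identityˡ _)

  ⟪shift₂⟫ : ∀ n a → ⟪ shift₂ K.0# a ⟫ (suc n) ≈ sumDiag n (λ j d → term (shift₂ K.0# a) j (suc d))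
  ⟪shift₂⟫ n a = trans (sumDiag-sucʳ n (term (shift₂ K.0# a)))
                       (trans (+-congˡ (term-zero (shift₂ K.0# a) (suc n) 0 K.refl)) (+-identityʳ _))

  E₄-sum : ∀ n a → sumDiag (suc n) (E₄-term a) ≈ E₄ * ⟪ derivE₂ a ⟫ n
  E₄-sum n a = trans (sumDiag-sucʳ n (E₄-term a))
                     (trans (+-identityʳ _) (sym (sumDiag-homo (distribˡ E₄) n (term (derivE₂ a)))))

  ϑ-term-leibniz : ∀ w a j d →
    ϑ w (term a j d) ≈ φ (a j d) * (pow E₂ d * X (suc j) + 𝒟 (pow E₂ d) * X j) - φ w * E₂ * term a j d
  ϑ-term-leibniz w a j d = +-congʳ (trans (𝒟-· (a j d) _) (*-congˡ (𝒟-leibniz (pow E₂ d) (X j))))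

  ϑ-term : ∀ w a j d →
    ϑ w (term a j d) ≈ term (shift₁ K.0# a) (suc j) d + (term (shift₂ K.0# (weighted w a)) j (suc d) + E₄-term a j d)
  ϑ-term w a j zero = begin
    ϑ w (term a j 0)
      ≈⟨ ϑ-term-leibniz w a j 0 ⟩
    α * (1# * X (suc j) + 𝒟 1# * X j) - ω * E₂ * (α * (1# * X j))
      ≈⟨ +-congʳ (*-congˡ (+-congˡ (*-congʳ 𝒟-1#))) ⟩
    α * (1# * X (suc j) + 0# * X j) - ω * E₂ * (α * (1# * X j))
      ≈⟨ solve 5 (λ α ω e x x′ →
             α :* (𝟙 :* x′ :+ con (+ 0) :* x) :- ω :* e :* (α :* (𝟙 :* x))
          := α :* (𝟙 :* x′) :+ ((con (+ 0) :- ω) :* α :* ((e :* 𝟙) :* x) :+ con (+ 0)))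
          refl α ω E₂ (X j) (X (suc j)) ⟩
    α * (1# * X (suc j)) + ((fromℕ 0 - ω) * α * ((E₂ * 1#) * X j) + 0#)
      ≈⟨ +-congˡ (+-congʳ (*-congʳ (φ-affine 0 w (a j 0)))) ⟨
    α * (1# * X (suc j)) + (φ (weighted w a j 0) * ((E₂ * 1#) * X j) + 0#) ∎
    where
    α = φ (a j 0)
    ω = φ w
  ϑ-term w a j (suc e) = begin
    ϑ w (term a j (suc e))
      ≈⟨ ϑ-term-leibniz w a j (suc e) ⟩
    α * (E₂ * P * X (suc j) + 𝒟 (E₂ * P) * X j) - ω * E₂ * (α * (E₂ * P * X j))
      ≈⟨ +-congʳ (*-congˡ (+-congˡ (*-congʳ (trans (𝒟-pow E₂ e) (*-congˡ (*-congˡ 𝒟-E₂)))))) ⟩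
    α * (E₂ * P * X (suc j) + fromℕ (suc e) * (P * (E₄ + E₂ * E₂)) * X j) - ω * E₂ * (α * (E₂ * P * X j))
      ≈⟨ solve 8 (λ α ω n e f p x x′ →
             α :* (e :* p :* x′ :+ (𝟙 :+ n) :* (p :* (f :+ e :* e)) :* x) :- ω :* e :* (α :* (e :* p :* x))
          := α :* (e :* p :* x′) :+ (((𝟙 :+ n) :- ω) :* α :* (e :* (e :* p) :* x) :+ f :* ((𝟙 :+ n) :* α :* (p :* x))))
          refl α ω (fromℕ e) E₂ E₄ P (X j) (X (suc j)) ⟩
    α * (E₂ * P * X (suc j)) + ((fromℕ (suc e) - ω) * α * (E₂ * (E₂ * P) * X j) + E₄ * (fromℕ (suc e) * α * (P * X j)))
      ≈⟨ +-congˡ (+-cong (*-congʳ (φ-affine (suc e) w (a j (suc e))))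
                         (*-congˡ (*-congʳ (φ-scale (suc e) (a j (suc e)))))) ⟨
    α * (E₂ * P * X (suc j)) + (φ (weighted w a j (suc e)) * (E₂ * (E₂ * P) * X j)
                                + E₄ * (φ (derivE₂ a j e) * (P * X j))) ∎
    where
    α = φ (a j (suc e))
    ω = φ w
    P = pow E₂ e

  ϑ-⟪⟫ : ∀ w a m → ϑ w (⟪ a ⟫ m) ≈ ⟪ ϑ-coeff w a ⟫ (suc m) + sumDiag m (E₄-term a)
  ϑ-⟪⟫ w a m = begin
    ϑ w (⟪ a ⟫ m)
      ≈⟨ sumDiag-homo (ϑ-+ w) m (term a) ⟩
    sumDiag m (λ j d → ϑ w (term a j d))
      ≈⟨ sumDiag-cong m (λ j d _ → ϑ-term w a j d) ⟩
    sumDiag m (λ j d → t₁ j d + (t₂ j d + E₄-term a j d))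
      ≈⟨ trans (sumDiag-+ m t₁ _) (+-congˡ (sumDiag-+ m t₂ (E₄-term a))) ⟩
    sumDiag m t₁ + (sumDiag m t₂ + sumDiag m (E₄-term a))
      ≈⟨ +-assoc _ _ _ ⟨
    sumDiag m t₁ + sumDiag m t₂ + sumDiag m (E₄-term a)
      ≈⟨ +-congʳ (+-cong (⟪shift₁⟫ m a) (⟪shift₂⟫ m (weighted w a))) ⟨
    ⟪ shift₁ K.0# a ⟫ (suc m) + ⟪ shift₂ K.0# (weighted w a) ⟫ (suc m) + sumDiag m (E₄-term a)
      ≈⟨ +-congʳ (⟪⟫-+ (suc m) (shift₁ K.0# a) (shift₂ K.0# (weighted w a))) ⟨
    ⟪ ϑ-coeff w a ⟫ (suc m) + sumDiag m (E₄-term a) ∎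
    where
    t₁ t₂ : ℕ → ℕ → Carrier
    t₁ j d = term (shift₁ K.0# a) (suc j) d
    t₂ j d = term (shift₂ K.0# (weighted w a)) j (suc d)

  module _ (κ : K.Carrier) where
    open SerreCoefficients K κ

    ⟪serreCoeff⟫-zero : ⟪ serreCoeff ⟫ 0 ≈ x
    ⟪serreCoeff⟫-zero = begin
      φ (serreCoeff 0 0) * (1# * x)  ≈⟨ *-congʳ (trans (φ.⟦⟧-cong (serreCoeff-zeroʳ 0)) φ.1#-homo) ⟩
      1# * (1# * x)                  ≈⟨ trans (*-identityˡ _) (*-identityˡ x) ⟩
      x                              ∎

    ϑ-⟪serreCoeff⟫ : ∀ m → ϑ (weight m) (⟪ serreCoeff ⟫ m) ≈ ⟪ serreCoeff ⟫ (suc m) + sumDiag m (E₄-term serreCoeff)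
    ϑ-⟪serreCoeff⟫ m = trans (ϑ-⟪⟫ (weight m) serreCoeff m) (+-congʳ (sym (⟪⟫-cong (suc m) (serreCoeff-rec m))))

    ⟪serreCoeff⟫-one : ⟪ serreCoeff ⟫ 1 ≈ ϑ (weight 0) (⟪ serreCoeff ⟫ 0)
    ⟪serreCoeff⟫-one = sym (trans (ϑ-⟪serreCoeff⟫ 0) (+-identityʳ _))

    E₄-cancel : ∀ n → sumDiag (suc n) (E₄-term serreCoeff) + φ (E₄Coeff n) * E₄ * ⟪ serreCoeff ⟫ n ≈ 0#
    E₄-cancel n = begin
      sumDiag (suc n) (E₄-term serreCoeff) + φ s * E₄ * ⟪ serreCoeff ⟫ n
        ≈⟨ +-congʳ (E₄-sum n serreCoeff) ⟩
      E₄ * ⟪ derivE₂ serreCoeff ⟫ n + φ s * E₄ * ⟪ serreCoeff ⟫ n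
        ≈⟨ solve 4 (λ e a s c → e :* a :+ s :* e :* c := e :* (a :+ s :* c)) refl E₄ _ (φ s) _ ⟩
      E₄ * (⟪ derivE₂ serreCoeff ⟫ n + φ s * ⟪ serreCoeff ⟫ n)
        ≈⟨ *-congˡ (+-congˡ (⟪⟫-*ˡ n s serreCoeff)) ⟩
      E₄ * (⟪ derivE₂ serreCoeff ⟫ n + ⟪ (λ j d → s K.* serreCoeff j d) ⟫ n)
        ≈⟨ *-congˡ (⟪⟫-+ n _ _) ⟨
      E₄ * ⟪ (λ j d → derivE₂ serreCoeff j d K.+ s K.* serreCoeff j d) ⟫ n
        ≈⟨ *-congˡ (⟪⟫-≈0 n vanishes) ⟩
      E₄ * 0#
        ≈⟨ zeroʳ E₄ ⟩
      0# ∎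
      where
      s = E₄Coeff n
      vanishes : ∀ j d → j ℕ.+ d ≡ n → derivE₂ serreCoeff j d K.+ s K.* serreCoeff j d K.≈ K.0#
      vanishes j d ≡.refl = serreCoeff-E₄ j d

    ⟪serreCoeff⟫-suc-suc : ∀ n →
      ⟪ serreCoeff ⟫ (suc (suc n))
        ≈ ϑ (weight (suc n)) (⟪ serreCoeff ⟫ (suc n)) + φ (E₄Coeff n) * E₄ * ⟪ serreCoeff ⟫ n
    ⟪serreCoeff⟫-suc-suc n = begin
      c₂                 ≈⟨ +-identityʳ c₂ ⟨
      c₂ + 0#            ≈⟨ +-congˡ (E₄-cancel n) ⟨
      c₂ + (Σ₄ + t₄)     ≈⟨ +-assoc c₂ Σ₄ t₄ ⟨
      c₂ + Σ₄ + t₄       ≈⟨ +-congʳ (ϑ-⟪serreCoeff⟫ (suc n)) ⟨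
      ϑ (weight (suc n)) (⟪ serreCoeff ⟫ (suc n)) + t₄ ∎
      where
      c₂ = ⟪ serreCoeff ⟫ (suc (suc n))
      Σ₄ = sumDiag (suc n) (E₄-term serreCoeff)
      t₄ = φ (E₄Coeff n) * E₄ * ⟪ serreCoeff ⟫ n

module SerreIterExpansion
    {k kℓ m mℓ h t tℓ : Level}
    (K : Field k kℓ) (char0 : CharZero K) (N : ℕ) (N>0 : 0 < N)
    (M : GradedAlgebra K N m mℓ h)
    (∂ : GradedAlgebra.Carrier M → GradedAlgebra.Carrier M) (∂-der : IsDerivation2 M ∂)
    (E₄ : GradedAlgebra.Carrier M) (E₄-hom : GradedAlgebra.Hom M (+ (4 ℕ.* N)) E₄)
    (M̃ : PolynomialExtension M t tℓ)
    (𝒟 : PolynomialExtension.Carrier M̃ → PolynomialExtension.Carrier M̃)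
    (𝒟-der : IsScriptD char0 N>0 ∂ E₄ M̃ 𝒟)
    (a : ℤ) (f : GradedAlgebra.Carrier M) (f-hom : GradedAlgebra.Hom M a f)
    where

  private
    module K where
      open Field K public
      open RingOps commutativeRing public
    module M = GradedAlgebra M
  open PolynomialExtension M̃
  private
    module incl = IsRingHomomorphism incl-hom
  open IsDerivation2 ∂-der using (∂-degree)
  open IsScriptD 𝒟-der
  open DiagonalSums cring
  open RingOpsProperties cring using (module Solver)
  open import Relation.Binary.Reasoning.Setoid setoid

  degreeOf : ℤ → K.Carrier
  degreeOf = degree K char0 N N>0

  open SerreCoefficients K.commutativeRing (degreeOf a)

  φ : K.Carrier → Carrier
  φ c = incl (M.ι c)

  φ-hom : IsRingHomomorphism K.rawRing rawRing φ
  φ-hom = isRingHomomorphism trans M.ι-hom incl-hom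

  𝒟-linear : IsLinearDerivation {K = K.commutativeRing} cring φ 𝒟
  𝒟-linear = record { 𝒟-cong = 𝒟-cong ; 𝒟-+ = 𝒟-+ ; 𝒟-· = 𝒟-· ; 𝒟-leibniz = 𝒟-leibniz }

  open Expansion cring φ-hom 𝒟-linear E₂ (incl E₄) 𝒟-E₂ (incl f)

  S : ℕ → M.Carrier
  S n = serreIter M ∂ E₄ (degreeOf a) n f

  deg : ℕ → ℤ
  deg zero    = a
  deg (suc n) = deg n ℤ.+ + (2 ℕ.* N)

  S-hom : ∀ n → M.Hom (deg n) (S n)
  S-hom zero          = f-hom
  S-hom (suc zero)    = ∂-degree f-hom
  S-hom (suc (suc n)) = M.Hom-+ (∂-degree (S-hom (suc n)))
    (≡.subst (λ i → M.Hom i (M.ι (E₄Coeff n) M.* E₄ M.* S n)) (+[4*n]+i≡i+[2*n]+[2*n] N (deg n))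
             (M.Hom-* (M.Hom-· (E₄Coeff n) E₄-hom) (S-hom n)))

  degreeOf-deg : ∀ n → degreeOf (deg n) K.≈ weight n
  degreeOf-deg zero    = K.sym (K.+-identityʳ _)
  degreeOf-deg (suc n) = K.trans (degree-+ K char0 N>0 (deg n) 2) (K.trans (K.+-congʳ (degreeOf-deg n)) (weight-suc n))

  incl-∂ : ∀ {i g} → M.Hom i g → incl (∂ g) ≈ ϑ (degreeOf i) (incl g)
  incl-∂ {i} {g} g-hom = begin
    incl (∂ g)            ≈⟨ solve 2 (λ y z → y := (y :+ z) :- z) refl (incl (∂ g)) w ⟩
    (incl (∂ g) + w) - w  ≈⟨ +-congʳ (𝒟-M g-hom) ⟨
    𝒟 (incl g) - w        ∎
    where
    open Solver
    w = φ (degreeOf i) * E₂ * incl g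

  incl-S : ∀ n → incl (S n) ≈ ⟪ serreCoeff ⟫ n
  incl-S zero          = sym (⟪serreCoeff⟫-zero (degreeOf a))
  incl-S (suc zero)    = begin
    incl (∂ f)                        ≈⟨ incl-∂ f-hom ⟩
    ϑ (degreeOf a) (incl f)           ≈⟨ ϑ-cong (degreeOf-deg 0) (incl-S 0) ⟩
    ϑ (weight 0) (⟪ serreCoeff ⟫ 0)   ≈⟨ ⟪serreCoeff⟫-one (degreeOf a) ⟨
    ⟪ serreCoeff ⟫ 1                  ∎
  incl-S (suc (suc n)) = begin
    incl (∂ (S (suc n)) M.+ M.ι (E₄Coeff n) M.* E₄ M.* S n)
      ≈⟨ incl.+-homo _ _ ⟩
    incl (∂ (S (suc n))) + incl (M.ι (E₄Coeff n) M.* E₄ M.* S n)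
      ≈⟨ +-cong (incl-∂ (S-hom (suc n))) (trans (incl.*-homo _ _) (*-congʳ (incl.*-homo _ _))) ⟩
    ϑ (degreeOf (deg (suc n))) (incl (S (suc n))) + φ (E₄Coeff n) * incl E₄ * incl (S n)
      ≈⟨ +-cong (ϑ-cong (degreeOf-deg (suc n)) (incl-S (suc n))) (*-congˡ (incl-S n)) ⟩
    ϑ (weight (suc n)) (⟪ serreCoeff ⟫ (suc n)) + φ (E₄Coeff n) * incl E₄ * ⟪ serreCoeff ⟫ n
      ≈⟨ ⟪serreCoeff⟫-suc-suc (degreeOf a) n ⟨
    ⟪ serreCoeff ⟫ (suc (suc n)) ∎

  coeff≈serreCoeff : ∀ {n j} → j ℕ.≤ n → coeff K (degreeOf a) n j K.≈ serreCoeff j (n ∸ j)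
  coeff≈serreCoeff {n} {j} j≤n =
    ≡.subst (λ n′ → coeff K (degreeOf a) n′ j K.≈ serreCoeff j d) (ℕ.m+[n∸m]≡n j≤n) (reindexed (ℕ.m+n∸m≡n j d))
    where
    d = n ∸ j
    -- coeff carries an instance argument mentioning (j + d) ∸ j, so that index is generalised
    -- before it is identified with d.
    reindexed : ∀ {e} → e ≡ d →
      K.pow (K.- K.1#) e K.* K.fromℕ (((j ℕ.+ d) ! / (e ! ℕ.* j !)) {{ℕ._!*_!≢0 e j}}) K.* K.poch (degreeOf a K.+ K.fromℕ j) e
        K.≈ serreCoeff j d
    reindexed ≡.refl = K.*-congʳ (K.*-congˡ (K.reflexive (≡.cong K.fromℕ ([j+d]!/[d!*j!]≡[j+d]Cd j d))))

  ⟪serreCoeff⟫≈sumTo : ∀ n → ⟪ serreCoeff ⟫ n ≈ sumTo n (λ j → φ (coeff K (degreeOf a) n j) * pow E₂ (n ∸ j) * X j)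
  ⟪serreCoeff⟫≈sumTo n = trans (sym (sumTo≈sumDiag n (term serreCoeff))) (sumTo-cong n reassociate)
    where
    reassociate : ∀ j → j ℕ.≤ n → term serreCoeff j (n ∸ j) ≈ φ (coeff K (degreeOf a) n j) * pow E₂ (n ∸ j) * X j
    reassociate j j≤n =
      trans (*-congʳ (IsRingHomomorphism.⟦⟧-cong φ-hom (K.sym (coeff≈serreCoeff j≤n)))) (sym (*-assoc _ _ _))

open import Data.Nat using (_*_)

lemma4p1 : ∀ {k kℓ m mℓ h t tℓ : Level}
    (K : Field k kℓ) (char0 : CharZero K)
    (N : ℕ) (N>0 : 0 < N)
    (M : GradedAlgebra K N m mℓ h)
    (∂ : GradedAlgebra.Carrier M → GradedAlgebra.Carrier M) → IsDerivation2 M ∂ →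
    (E₄ : GradedAlgebra.Carrier M) → GradedAlgebra.Hom M (+ (4 * N)) E₄ →
    (M̃ : PolynomialExtension M t tℓ)
    (𝒟 : PolynomialExtension.Carrier M̃ → PolynomialExtension.Carrier M̃) →
    IsScriptD char0 N>0 ∂ E₄ M̃ 𝒟 →
    (a : ℤ) (f : GradedAlgebra.Carrier M) → GradedAlgebra.Hom M a f → (n : ℕ) →
    PolynomialExtension._≈_ M̃
      (PolynomialExtension.incl M̃ (serreIter M ∂ E₄ (degree K char0 N N>0 a) n f))
      (PolynomialExtension.sumTo M̃ n (λ j →
         PolynomialExtension._*_ M̃
           (PolynomialExtension._*_ M̃
             (PolynomialExtension.incl M̃
               (GradedAlgebra.ι M (coeff K (degree K char0 N N>0 a) n j)))
             (PolynomialExtension.pow M̃ (PolynomialExtension.E₂ M̃) (n ∸ j)))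
           (iter 𝒟 j (PolynomialExtension.incl M̃ f))))
lemma4p1 K char0 N N>0 M ∂ ∂-der E₄ E₄-hom M̃ 𝒟 𝒟-der a f f-hom n =
  PolynomialExtension.trans M̃ (incl-S n) (⟪serreCoeff⟫≈sumTo n)
  where open SerreIterExpansion K char0 N N>0 M ∂ ∂-der E₄ E₄-hom M̃ 𝒟 𝒟-der a f f-hom
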